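{- The program NQUEENS is recurrent with respect to the level mapping $|\cdot|$ defined by $|pqs(i,cs,us,ds)| = |i|+|cs|$ and $|pq(i,cs,us,ds)| = |cs|$, where on ground terms $|[h|t]| = 1+|t|$, $|s(t)| = 1+|t|$, and $|f(t_1,\ldots,t_n)| = 0$ for every $n$-ary function symbol $f$ ($n\ge0$) other than $s$ and the list constructor $[\cdot|\cdot]$. Consequently the program terminates for every initial query $pqs(n,q_0,\_,\_)$ where $q_0$ is a list of $n$ distinct variables.
   Context: NQUEENS is the definite logic program (Prolog syntax, natural numbers represented as $0, s(0), s(s(0)),\ldots$; each \_ is a distinct variable): pqs(0,_,_,_). pqs(s(I),Cs,Us,[_|Ds]) :- pqs(I,Cs,[_|Us],Ds), pq(s(I),Cs,Us,Ds). pq(I,[I|_],[I|_],[I|_]). pq(I,[_|Cs],[_|Us],[_|Ds]) :- pq(I,Cs,Us,Ds). A level mapping is a function from ground atoms to natural numbers. A program is recurrent w.r.t.\ a level mapping $|\cdot|$ when for each ground instance $H\gets B_1,\ldots,B_n$ ($n\ge 0$) of a clause of the program and each $i\in\{1,\ldots,n\}$, $|H|>|B_i|$. -}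

module Defs where

open import Data.Nat using (ℕ; zero; suc; _+_; _<_)
open import Data.Empty using (⊥)
open import Data.List using (List; []; _∷_; _++_; map; concatMap)
open import Data.Vec using (Vec; []; _∷_)
open import Data.List.Membership.Propositional using (_∈_)
open import Data.List.Relation.Unary.All using (All)
open import Data.Product using (Σ; ∃; _×_)
open import Relation.Binary.PropositionalEquality using (_≡_)
open import Relation.Nullary using (¬_)
open import Function.Definitions using (Injective)

-- First-order terms over variables V.
-- Function symbols: 0, s/1, [] , [.|.]/2, and arbitrarily many other
-- symbols  fn f  of any arity n (symbol identified by (f, n)).

data Term (V : Set) : Set where
  var  : V → Term V
  zro  : Term V
  suc' : Term V → Term V
  nil  : Term V
  cons : Term V → Term V → Term V
  fn   : (f : ℕ) {n : ℕ} → Vec (Term V) n → Term V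

GTerm : Set
GTerm = Term ⊥

mutual
  substT : {V W : Set} → (V → Term W) → Term V → Term W
  substT σ (var x)    = σ x
  substT σ zro        = zro
  substT σ (suc' t)   = suc' (substT σ t)
  substT σ nil        = nil
  substT σ (cons h t) = cons (substT σ h) (substT σ t)
  substT σ (fn f ts)  = fn f (substTs σ ts)

  substTs : {V W : Set} {n : ℕ} → (V → Term W) → Vec (Term V) n → Vec (Term W) n
  substTs σ []       = []
  substTs σ (t ∷ ts) = substT σ t ∷ substTs σ ts

mutual
  varsT : {V : Set} → Term V → List V
  varsT (var x)    = x ∷ []
  varsT zro        = []
  varsT (suc' t)   = varsT t
  varsT nil        = []
  varsT (cons h t) = varsT h ++ varsT t
  varsT (fn f ts)  = varsTs ts

  varsTs : {V : Set} {n : ℕ} → Vec (Term V) n → List V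
  varsTs []       = []
  varsTs (t ∷ ts) = varsT t ++ varsTs ts

data Atom (V : Set) : Set where
  pqs : Term V → Term V → Term V → Term V → Atom V
  pq  : Term V → Term V → Term V → Term V → Atom V

substA : {V W : Set} → (V → Term W) → Atom V → Atom W
substA σ (pqs a b c d) = pqs (substT σ a) (substT σ b) (substT σ c) (substT σ d)
substA σ (pq  a b c d) = pq  (substT σ a) (substT σ b) (substT σ c) (substT σ d)

varsA : {V : Set} → Atom V → List V
varsA (pqs a b c d) = varsT a ++ varsT b ++ varsT c ++ varsT d
varsA (pq  a b c d) = varsT a ++ varsT b ++ varsT c ++ varsT d

record Clause (V : Set) : Set where
  constructor _⇐_
  field
    head : Atom V
    body : List (Atom V)
open Clause public

substC : {V W : Set} → (V → Term W) → Clause V → Clause W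
substC σ (h ⇐ bs) = substA σ h ⇐ map (substA σ) bs

varsC : {V : Set} → Clause V → List V
varsC (h ⇐ bs) = varsA h ++ concatMap varsA bs

Program : Set
Program = List (Clause ℕ)

Goal : Set
Goal = List (Atom ℕ)

substG : (ℕ → Term ℕ) → Goal → Goal
substG σ = map (substA σ)

varsG : Goal → List ℕ
varsG = concatMap varsA

-- The program NQUEENS (variables are natural numbers; each _ a fresh one)

private
  v : ℕ → Term ℕ
  v = var

-- pqs(0,_,_,_).
clause1 : Clause ℕ
clause1 = pqs zro (v 0) (v 1) (v 2) ⇐ []

-- pqs(s(I),Cs,Us,[_|Ds]) :- pqs(I,Cs,[_|Us],Ds), pq(s(I),Cs,Us,Ds).
-- I = 0, Cs = 1, Us = 2, _ = 3, Ds = 4, _ = 5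
clause2 : Clause ℕ
clause2 = pqs (suc' (v 0)) (v 1) (v 2) (cons (v 3) (v 4))
          ⇐ (pqs (v 0) (v 1) (cons (v 5) (v 2)) (v 4)
             ∷ pq (suc' (v 0)) (v 1) (v 2) (v 4) ∷ [])

-- pq(I,[I|_],[I|_],[I|_]).   I = 0, _ = 1,2,3
clause3 : Clause ℕ
clause3 = pq (v 0) (cons (v 0) (v 1)) (cons (v 0) (v 2)) (cons (v 0) (v 3)) ⇐ []

-- pq(I,[_|Cs],[_|Us],[_|Ds]) :- pq(I,Cs,Us,Ds).
-- I = 0, _ = 1, Cs = 2, _ = 3, Us = 4, _ = 5, Ds = 6
clause4 : Clause ℕ
clause4 = pq (v 0) (cons (v 1) (v 2)) (cons (v 3) (v 4)) (cons (v 5) (v 6))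
          ⇐ (pq (v 0) (v 2) (v 4) (v 6) ∷ [])

NQUEENS : Program
NQUEENS = clause1 ∷ clause2 ∷ clause3 ∷ clause4 ∷ []

LevelMapping : Set
LevelMapping = Atom ⊥ → ℕ

Recurrent : Program → LevelMapping → Set
Recurrent P lvl =
  ∀ {c} → c ∈ P → (σ : ℕ → GTerm) →
    All (λ B → lvl B < lvl (head (substC σ c))) (body (substC σ c))

size : GTerm → ℕ
size (var ())
size zro        = 0
size (suc' t)   = suc (size t)
size nil        = 0
size (cons h t) = suc (size t)
size (fn f ts)  = 0

level : LevelMapping
level (pqs i cs us ds) = size i + size cs
level (pq  i cs us ds) = size cs

Unifier : (ℕ → Term ℕ) → Atom ℕ → Atom ℕ → Set
Unifier θ A B = substA θ A ≡ substA θ B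

MGU : (ℕ → Term ℕ) → Atom ℕ → Atom ℕ → Set
MGU θ A B = Unifier θ A B ×
  (∀ τ → Unifier τ A B → Σ (ℕ → Term ℕ) λ δ → ∀ x → τ x ≡ substT δ (θ x))

rename : (ℕ → ℕ) → Clause ℕ → Clause ℕ
rename ρ = substC (λ x → var (ρ x))

data SLDStep (P : Program) : Goal → Goal → Set where
  step : ∀ (pre : Goal) (A : Atom ℕ) (suf : Goal) {c : Clause ℕ} → c ∈ P →
         (ρ : ℕ → ℕ) → Injective _≡_ _≡_ ρ →
         (∀ x → x ∈ varsC (rename ρ c) → x ∈ varsG (pre ++ A ∷ suf) → ⊥) →
         (θ : ℕ → Term ℕ) → MGU θ A (head (rename ρ c)) →
         SLDStep P (pre ++ A ∷ suf)
                   (substG θ (pre ++ body (rename ρ c) ++ suf))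

Terminates : Program → Goal → Set
Terminates P G =
  ¬ (Σ (ℕ → Goal) λ f → (f 0 ≡ G) × (∀ k → SLDStep P (f k) (f (suc k))))

numeral : ℕ → Term ℕ
numeral zero    = zro
numeral (suc n) = suc' (numeral n)

varList : List ℕ → Term ℕ
varList []       = nil
varList (x ∷ xs) = cons (var x) (varList xs)

-- For termination, call an atom bounded by n when all
-- its ground instances have level < n.  If the selected atom is bounded by n, lifting each
-- ground instance of the resolvent to a ground instance of the program clause shows, via
-- recurrence, that every new body atom is bounded by n − 1.  As bodies have at most two atoms,
-- the sum of 3 ^ bound over the goal strictly decreases along an SLD derivation, so every
-- derivation from a goal of bounded atoms is finite; the query is bounded by 1 + n + length q₀.
module Submission where

open import Defs
open import Data.Nat using (ℕ; zero; suc; _+_; _*_; _^_; _≤_; _<_; z≤n; s≤s; s≤s⁻¹)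
open import Data.Nat.Properties
open import Data.Nat.Induction using (<-wellFounded)
open import Data.Empty using (⊥; ⊥-elim)
open import Data.List using (List; []; _∷_; _++_; map; length)
open import Data.List.Properties using (map-∘; map-cong; map-++; length-map)
open import Data.List.Membership.Propositional using (_∈_; _∉_)
open import Data.List.Relation.Unary.All as All using (All; []; _∷_)
open import Data.List.Relation.Unary.All.Properties using (map⁻; ++⁺; ++⁻)
open import Data.List.Relation.Unary.Any using (here; there)
open import Data.List.Relation.Unary.Unique.Propositional using (Unique)
open import Data.Product using (Σ-syntax; ∃-syntax; _×_; _,_; proj₁; proj₂)
open import Data.Vec using (Vec; []; _∷_)
open import Function using (_∘_)
open import Induction.WellFounded using (Acc; acc)
open import Relation.Nullary using (¬_)
open import Relation.Binary.PropositionalEquality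
  using (_≡_; _≢_; refl; sym; trans; cong; cong₂; subst; module ≡-Reasoning)

mutual
  substT-∘ : ∀ {U V W : Set} (τ : V → Term W) (σ : U → Term V) (t : Term U) →
             substT τ (substT σ t) ≡ substT (substT τ ∘ σ) t
  substT-∘ τ σ (var x)    = refl
  substT-∘ τ σ zro        = refl
  substT-∘ τ σ (suc' t)   = cong suc' (substT-∘ τ σ t)
  substT-∘ τ σ nil        = refl
  substT-∘ τ σ (cons h t) = cong₂ cons (substT-∘ τ σ h) (substT-∘ τ σ t)
  substT-∘ τ σ (fn f ts)  = cong (fn f) (substTs-∘ τ σ ts)

  substTs-∘ : ∀ {U V W : Set} {n : ℕ} (τ : V → Term W) (σ : U → Term V) (ts : Vec (Term U) n) →
              substTs τ (substTs σ ts) ≡ substTs (substT τ ∘ σ) ts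
  substTs-∘ τ σ []       = refl
  substTs-∘ τ σ (t ∷ ts) = cong₂ _∷_ (substT-∘ τ σ t) (substTs-∘ τ σ ts)

substA-∘ : ∀ {U V W : Set} (τ : V → Term W) (σ : U → Term V) (A : Atom U) →
           substA τ (substA σ A) ≡ substA (substT τ ∘ σ) A
substA-∘ τ σ (pqs a b c d)
  rewrite substT-∘ τ σ a | substT-∘ τ σ b | substT-∘ τ σ c | substT-∘ τ σ d = refl
substA-∘ τ σ (pq a b c d)
  rewrite substT-∘ τ σ a | substT-∘ τ σ b | substT-∘ τ σ c | substT-∘ τ σ d = refl

substC-∘ : ∀ {U V W : Set} (τ : V → Term W) (σ : U → Term V) (c : Clause U) →
           substC τ (substC σ c) ≡ substC (substT τ ∘ σ) c
substC-∘ τ σ (h ⇐ bs) = cong₂ _⇐_ (substA-∘ τ σ h) (begin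
  map (substA τ) (map (substA σ) bs)  ≡⟨ map-∘ bs ⟨
  map (substA τ ∘ substA σ) bs        ≡⟨ map-cong (substA-∘ τ σ) bs ⟩
  map (substA (substT τ ∘ σ)) bs      ∎)
  where open ≡-Reasoning

few-powers-below-next : ∀ {ℓ k} m → ℓ ≤ k → ℓ * suc k ^ m < suc k ^ suc m
few-powers-below-next {ℓ} {k} m ℓ≤k = begin-strict
  ℓ * suc k ^ m      ≤⟨ *-monoˡ-≤ (suc k ^ m) ℓ≤k ⟩
  k * suc k ^ m      <⟨ *-monoˡ-< (suc k ^ m) {{m^n≢0 (suc k) m}} (n<1+n k) ⟩
  suc k * suc k ^ m  ∎
  where open ≤-Reasoning

no-descending-chain : (w : ℕ → ℕ) → (∀ i → w (suc i) < w i) → ⊥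
no-descending-chain w descends = go 0 (<-wellFounded (w 0))
  where
  go : ∀ i → Acc _<_ (w i) → ⊥
  go i (acc rs) = go (suc i) (rs (descends i))

module _ (lvl : LevelMapping) where

  Bounded : ℕ → Atom ℕ → Set
  Bounded n A = ∀ (τ : ℕ → GTerm) → lvl (substA τ A) < n

  ¬Bounded-zero : ∀ {A} → ¬ Bounded 0 A
  ¬Bounded-zero bounded = n≮0 (bounded (λ _ → zro))

  Bounded-subst : ∀ {n A} (θ : ℕ → Term ℕ) → Bounded n A → Bounded n (substA θ A)
  Bounded-subst {n} {A} θ bounded τ =
    subst (λ B → lvl B < n) (sym (substA-∘ τ θ A)) (bounded (substT τ ∘ θ))

  -- Lifting: a ground instance τ of the resolvent comes from the ground instance τ ∘ θ ∘ ρ of c.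
  resolvent-bounded : ∀ {P c A m} → Recurrent P lvl → c ∈ P →
    (ρ : ℕ → ℕ) (θ : ℕ → Term ℕ) → Unifier θ A (head (rename ρ c)) → Bounded (suc m) A →
    All (Bounded m) (substG θ (body (rename ρ c)))
  resolvent-bounded {c = c} {A} {m} recurrent c∈P ρ θ unifies bounded =
    All.tabulate λ B∈ τ →
      <-≤-trans (All.lookup (body<head τ) B∈) (s≤s⁻¹ (Bounded-subst {A = A} θ bounded τ))
    where
    instance≡ : ∀ τ → substC τ (substC θ (rename ρ c)) ≡ substC (λ x → substT τ (θ (ρ x))) c
    instance≡ τ = trans (substC-∘ τ θ (rename ρ c))
                        (substC-∘ (substT τ ∘ θ) (λ x → var (ρ x)) c)

    body<head : ∀ τ → All (λ B → lvl (substA τ B) < lvl (substA τ (substA θ A)))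
                          (substG θ (body (rename ρ c)))
    body<head τ = map⁻ (subst (λ H → All (λ B → lvl B < lvl (substA τ H)) _) (sym unifies)
                         (subst (λ d → All (λ B → lvl B < lvl (head d)) (body d)) (sym (instance≡ τ))
                           (recurrent c∈P (λ x → substT τ (θ (ρ x))))))

  BoundedGoal : Goal → Set
  BoundedGoal = All (λ A → ∃[ n ] Bounded n A)

  -- In base b, one atom with bound n outweighs fewer than b atoms with bound n − 1.
  weight : ∀ {G} → ℕ → BoundedGoal G → ℕ
  weight b []             = 0
  weight b ((n , _) ∷ bs) = b ^ n + weight b bs

  weight-++⁺ : ∀ {G G′} b (bs : BoundedGoal G) (bs′ : BoundedGoal G′) →
               weight b (++⁺ bs bs′) ≡ weight b bs + weight b bs′
  weight-++⁺ b []             bs′ = refl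
  weight-++⁺ b ((n , _) ∷ bs) bs′ =
    trans (cong (b ^ n +_) (weight-++⁺ b bs bs′)) (sym (+-assoc (b ^ n) _ _))

  weight-++⁻ : ∀ {G′} b G (bs : BoundedGoal (G ++ G′)) →
               weight b bs ≡ weight b (proj₁ (++⁻ G bs)) + weight b (proj₂ (++⁻ G bs))
  weight-++⁻ b []      bs             = refl
  weight-++⁻ b (_ ∷ G) ((n , _) ∷ bs) =
    trans (cong (b ^ n +_) (weight-++⁻ b G bs)) (sym (+-assoc (b ^ n) _ _))

  substBoundedGoal : ∀ {G} (θ : ℕ → Term ℕ) → BoundedGoal G → BoundedGoal (substG θ G)
  substBoundedGoal θ []                   = []
  substBoundedGoal θ ((n , bounded) ∷ bs) = (n , Bounded-subst θ bounded) ∷ substBoundedGoal θ bs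

  weight-substBoundedGoal : ∀ {G} b (θ : ℕ → Term ℕ) (bs : BoundedGoal G) →
                            weight b (substBoundedGoal θ bs) ≡ weight b bs
  weight-substBoundedGoal b θ []             = refl
  weight-substBoundedGoal b θ ((n , _) ∷ bs) = cong (b ^ n +_) (weight-substBoundedGoal b θ bs)

  weight-transport : ∀ {G G′} b (G≡G′ : G ≡ G′) (bs : BoundedGoal G) →
                     weight b (subst BoundedGoal G≡G′ bs) ≡ weight b bs
  weight-transport b refl bs = refl

  uniformBoundedGoal : ∀ {G} m → All (Bounded m) G → BoundedGoal G
  uniformBoundedGoal m = All.map (m ,_)

  weight-uniformBoundedGoal : ∀ {G} b m (bs : All (Bounded m) G) →
                              weight b (uniformBoundedGoal m bs) ≡ length G * b ^ m
  weight-uniformBoundedGoal b m []       = refl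
  weight-uniformBoundedGoal b m (_ ∷ bs) = cong (b ^ m +_) (weight-uniformBoundedGoal b m bs)

  weight-resolvent-< : ∀ {pre Bs suf k m} (θ : ℕ → Term ℕ) (bsPre : BoundedGoal pre)
    (bsBody : All (Bounded m) Bs) (bsSuf : BoundedGoal suf) → length Bs ≤ k →
    weight (suc k) (++⁺ (substBoundedGoal θ bsPre)
                        (++⁺ (uniformBoundedGoal m bsBody) (substBoundedGoal θ bsSuf)))
      < weight (suc k) bsPre + (suc k ^ suc m + weight (suc k) bsSuf)
  weight-resolvent-< {pre} {Bs} {suf} {k} {m} θ bsPre bsBody bsSuf short = begin-strict
    weight b (++⁺ bsPre′ (++⁺ bsBody′ bsSuf′))
      ≡⟨ weight-++⁺ b bsPre′ _ ⟩
    weight b bsPre′ + weight b (++⁺ bsBody′ bsSuf′)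
      ≡⟨ cong₂ _+_ (weight-substBoundedGoal b θ bsPre) (weight-++⁺ b bsBody′ bsSuf′) ⟩
    weight b bsPre + (weight b bsBody′ + weight b bsSuf′)
      ≡⟨ cong (λ w → weight b bsPre + (w + weight b bsSuf′))
              (weight-uniformBoundedGoal b m bsBody) ⟩
    weight b bsPre + (length Bs * b ^ m + weight b bsSuf′)
      ≡⟨ cong (λ w → weight b bsPre + (length Bs * b ^ m + w))
              (weight-substBoundedGoal b θ bsSuf) ⟩
    weight b bsPre + (length Bs * b ^ m + weight b bsSuf)
      <⟨ +-monoʳ-< (weight b bsPre)
                   (+-monoˡ-< (weight b bsSuf) (few-powers-below-next m short)) ⟩
    weight b bsPre + (b ^ suc m + weight b bsSuf) ∎
    where
    open ≤-Reasoning
    b : ℕ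
    b = suc k

    bsPre′ : BoundedGoal (substG θ pre)
    bsPre′ = substBoundedGoal θ bsPre

    bsBody′ : BoundedGoal Bs
    bsBody′ = uniformBoundedGoal m bsBody

    bsSuf′ : BoundedGoal (substG θ suf)
    bsSuf′ = substBoundedGoal θ bsSuf

  module _ {P : Program} {k : ℕ}
           (recurrent : Recurrent P lvl) (short : ∀ {c} → c ∈ P → length (body c) ≤ k) where

    sld-step-decreases : ∀ {G G′} → SLDStep P G G′ → (bs : BoundedGoal G) →
                         Σ[ bs′ ∈ BoundedGoal G′ ] weight (suc k) bs′ < weight (suc k) bs
    sld-step-decreases (step pre A suf {c} c∈P ρ _ _ θ (unifies , _)) bs
      with ++⁻ pre bs | weight-++⁻ (suc k) pre bs
    ... | _     , (zero  , bounded) ∷ _     | _     = ⊥-elim (¬Bounded-zero bounded)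
    ... | bsPre , (suc m , bounded) ∷ bsSuf | split =
      subst BoundedGoal (sym resolvent≡) bs′ ,
      (begin-strict
        weight (suc k) (subst BoundedGoal (sym resolvent≡) bs′)
          ≡⟨ weight-transport (suc k) (sym resolvent≡) bs′ ⟩
        weight (suc k) bs′
          <⟨ weight-resolvent-< θ bsPre bsBody bsSuf short-body ⟩
        weight (suc k) bsPre + (suc k ^ suc m + weight (suc k) bsSuf)
          ≡⟨ split ⟨
        weight (suc k) bs ∎)
      where
      open ≤-Reasoning
      Bs : Goal
      Bs = substG θ (body (rename ρ c))

      bsBody : All (Bounded m) Bs
      bsBody = resolvent-bounded recurrent c∈P ρ θ unifies bounded

      bs′ : BoundedGoal (substG θ pre ++ Bs ++ substG θ suf)
      bs′ = ++⁺ (substBoundedGoal θ bsPre)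
                (++⁺ (uniformBoundedGoal m bsBody) (substBoundedGoal θ bsSuf))

      resolvent≡ : substG θ (pre ++ body (rename ρ c) ++ suf) ≡ substG θ pre ++ Bs ++ substG θ suf
      resolvent≡ = trans (map-++ (substA θ) pre _)
                         (cong (substG θ pre ++_) (map-++ (substA θ) _ suf))

      short-body : length Bs ≤ k
      short-body = ≤-trans (≤-reflexive (trans (length-map (substA θ) (body (rename ρ c)))
                                               (length-map (substA (λ x → var (ρ x))) (body c))))
                           (short c∈P)

    recurrent⇒terminates : ∀ {G} → BoundedGoal G → Terminates P G
    recurrent⇒terminates bs (f , f0≡G , steps) =
      no-descending-chain (weight (suc k) ∘ bounds)
                          (λ i → proj₂ (sld-step-decreases (steps i) (bounds i)))
      where
      bounds : ∀ i → BoundedGoal (f i)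
      bounds zero    = subst BoundedGoal (sym f0≡G) bs
      bounds (suc i) = proj₁ (sld-step-decreases (steps i) (bounds i))

nqueens-recurrent : Recurrent NQUEENS level
nqueens-recurrent (here refl)                         σ = []
nqueens-recurrent (there (here refl))                 σ =
  ≤-refl ∷ s≤s (m≤n+m (size (σ 1)) (size (σ 0))) ∷ []
nqueens-recurrent (there (there (here refl)))         σ = []
nqueens-recurrent (there (there (there (here refl)))) σ = ≤-refl ∷ []

nqueens-bodies≤2 : ∀ {c} → c ∈ NQUEENS → length (body c) ≤ 2
nqueens-bodies≤2 (here refl)                         = z≤n
nqueens-bodies≤2 (there (here refl))                 = ≤-refl
nqueens-bodies≤2 (there (there (here refl)))         = z≤n
nqueens-bodies≤2 (there (there (there (here refl)))) = s≤s z≤n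

size-numeral : ∀ (τ : ℕ → GTerm) n → size (substT τ (numeral n)) ≡ n
size-numeral τ zero    = refl
size-numeral τ (suc n) = cong suc (size-numeral τ n)

size-varList : ∀ (τ : ℕ → GTerm) xs → size (substT τ (varList xs)) ≡ length xs
size-varList τ []       = refl
size-varList τ (_ ∷ xs) = cong suc (size-varList τ xs)

query-bounded : ∀ n q₀ (u d : ℕ) →
  Bounded level (suc (n + length q₀)) (pqs (numeral n) (varList q₀) (var u) (var d))
query-bounded n q₀ u d τ = s≤s (≤-reflexive (cong₂ _+_ (size-numeral τ n) (size-varList τ q₀)))

mainTheorem4 : Recurrent NQUEENS level
    × (∀ (n : ℕ) (q₀ : List ℕ) (u d : ℕ) → length q₀ ≡ n → Unique q₀
    → u ∉ q₀ → d ∉ q₀ → u ≢ d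
    → Terminates NQUEENS (pqs (numeral n) (varList q₀) (var u) (var d) ∷ []))
mainTheorem4 = nqueens-recurrent , λ n q₀ u d _ _ _ _ _ →
  recurrent⇒terminates level nqueens-recurrent nqueens-bodies≤2 ((_ , query-bounded n q₀ u d) ∷ [])
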